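{- Let $k\geq 2$, let $I\subset\{1,\dots,k\}$ and $\Pi_I=\{(\mathbf{x},\mathbf{y})\in\mathbb{R}^k\times\mathbb{R}^k:\sum_{i\in I}x_i+\sum_{i\notin I}y_i=0\}$. Let $\psi_1,\dots,\psi_s\in\Psi$ and let $\widetilde\psi_1,\dots,\widetilde\psi_s$ be their restrictions to $\Pi_I$. Suppose that $\widetilde\psi_1,\dots,\widetilde\psi_s$ are all distinct and that the subspace of $\Pi_I$ on which $\widetilde\psi_1,\dots,\widetilde\psi_s$ all take the same value has codimension at most $1$ in $\Pi_I$. Then $s\leq k$.
   Context: For $v\in\{1,\dots,k\}$ and $J\subset\{1,\dots,k\}$ let $\psi_{v,J}(\mathbf{x},\mathbf{y})=\sum_{i\in J}(v-i)x_i+\sum_{i\notin J}(v-i)y_i$; $\Psi$ is the set of all such linear forms on $\mathbb{R}^k\times\mathbb{R}^k$.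
   Formalization: The ambient space ℝ^k × ℝ^k is replaced by ℚ^k × ℚ^k, so Π_I and the subspace on which the restricted forms agree consist of points with rational coordinates. -}

module Defs where

open import Data.Nat using (ℕ; zero; suc)
open import Data.Fin using (Fin; toℕ) renaming (zero to fz; suc to fs)
open import Data.Fin.Subset using (Subset)
open import Data.Vec using (lookup)
open import Data.Bool using (if_then_else_)
open import Data.Integer using (+_) renaming (_-_ to _-ℤ_)
open import Data.Rational using (ℚ; 0ℚ; _+_; _*_; _/_)
open import Data.Product using (_×_; _,_; Σ; proj₁; proj₂)
open import Relation.Binary.PropositionalEquality using (_≡_)
open import Relation.Nullary using (¬_)

sumFin : (n : ℕ) → (Fin n → ℚ) → ℚ
sumFin zero    f = 0ℚ
sumFin (suc n) f = f fz + sumFin n (λ i → f (fs i))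

-- points (x , y) of ℚ^k × ℚ^k ; index i : Fin k stands for i+1 ∈ {1,…,k}
Point : ℕ → Set
Point k = (Fin k → ℚ) × (Fin k → ℚ)

sel : {k : ℕ} → Subset k → Point k → Fin k → ℚ
sel J (x , y) i = if lookup J i then x i else y i

InΠ : {k : ℕ} → Subset k → Point k → Set
InΠ {k} I p = sumFin k (sel I p) ≡ 0ℚ

-- an element of Ψ is named by a pair (v , J)
PsiIndex : ℕ → Set
PsiIndex k = Fin k × Subset k

ψ : {k : ℕ} → PsiIndex k → Point k → ℚ
ψ {k} (v , J) p = sumFin k (λ i → (((+ toℕ v) -ℤ (+ toℕ i)) / 1) * sel J p i)

_•_ : {k : ℕ} → ℚ → Point k → Point k
a • (x , y) = (λ i → a * x i) , (λ i → a * y i)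

_⊕_ : {k : ℕ} → Point k → Point k → Point k
(x , y) ⊕ (x' , y') = (λ i → x i + x' i) , (λ i → y i + y' i)

SameOnΠ : {k : ℕ} → Subset k → (Point k → ℚ) → (Point k → ℚ) → Set
SameOnΠ I f g = ∀ p → InΠ I p → f p ≡ g p

InW : {k s : ℕ} → Subset k → (Fin s → PsiIndex k) → Point k → Set
InW I ψs p = InΠ I p × (∀ a b → ψ (ψs a) p ≡ ψ (ψs b) p)

-- W has codimension ≤ 1 in Π_I, i.e. dim (Π_I / W) ≤ 1:
-- no two vectors of Π_I are linearly independent modulo W.
CodimLe1 : {k s : ℕ} → Subset k → (Fin s → PsiIndex k) → Set
CodimLe1 {k} I ψs =
  ∀ u w → InΠ I u → InΠ I w →
  Σ ℚ λ α → Σ ℚ λ β → ¬ (α ≡ 0ℚ × β ≡ 0ℚ) × InW I ψs ((α • u) ⊕ (β • w))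

{-# OPTIONS --safe #-}
-- If s > k, two of the forms share the index v (pigeonhole).  Forms with the
-- same v are determined by their values at the test points f_1, …, f_k of
-- Π_I, so these two differ at some f_i; in particular f_i ∉ W.  As W has
-- codimension ≤ 1 in Π_I, Π_I = W + ℚ f_i, hence two forms of the family
-- that agree at f_i agree on all of Π_I.  So the s forms take pairwise
-- distinct values at f_i; but every ψ_{v,J}(f_i) is of the form w - i with
-- w ∈ {1, …, k}, whence s ≤ k after all.
module Submission where

open import Defs
open import Data.Nat using (ℕ; _≤_)
open import Data.Fin using (Fin)
open import Data.Fin.Subset using (Subset)
open import Relation.Binary.PropositionalEquality using (_≡_)
open import Relation.Nullary using (¬_)

import Algebra.Properties.Group as GroupProperties
open import Algebra.Bundles using (AbelianGroup; CommutativeRing)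
open import Data.Bool using (Bool; true; false; if_then_else_; _xor_)
open import Data.Bool.Properties using (xor-same; not-¬; if-cong; if-cong-then; if-eta)
open import Data.Empty using (⊥-elim)
open import Data.Fin using (toℕ; _≟_; punchIn) renaming (zero to fz; suc to fs)
open import Data.Fin.Properties using (toℕ-injective; punchInᵢ≢i; pigeonhole; injective⇒≤; ¬∀⟶∃¬; <⇒≢)
open import Data.Integer as ℤ using (1ℤ)
import Data.Integer.Properties as ℤ
open import Data.Integer.GCD using (gcd; gcd-zeroʳ)
open import Data.Nat using (zero; suc; _≤?_)
open import Data.Nat.Properties using (≰⇒>)
open import Data.Product using (_,_; ∃; proj₁)
open import Data.Rational using (ℚ; 0ℚ; 1ℚ; _+_; _*_; _/_; 1/_; ↥_; ≢-nonZero)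
open import Data.Rational.Properties
  using (+-*-commutativeRing; +-0-group; ↥-/; *-assoc; *-identityˡ; *-identityʳ;
         *-inverseˡ; *-zeroˡ; *-zeroʳ; +-identityʳ)
  renaming (_≟_ to _≟ℚ_)
open import Data.Rational.Solver using (module +-*-Solver)
open import Data.Vec using (lookup)
open import Function using (_∘_)
open import Function.Definitions using (Injective)
open import Relation.Binary.PropositionalEquality using (_≢_; refl; sym; trans; cong; cong₂; module ≡-Reasoning)
open import Relation.Nullary using (Dec; yes; no; does)
open import Relation.Nullary.Decidable using (dec-true; dec-false; decidable-stable)

open import Algebra.Properties.Semiring.Sum (CommutativeRing.semiring +-*-commutativeRing)
  using (sum; sum-cong-≗; ∑-distrib-+; *-distribˡ-sum; sum-remove; sum-replicate-zero)
open GroupProperties +-0-group using (∙-cancelˡ)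

open ≡-Reasoning

if-injective : ∀ {a} {A : Set a} {v w : A} → v ≢ w → ∀ b c →
               (if b then v else w) ≡ (if c then v else w) → b ≡ c
if-injective v≢w true  true  _  = refl
if-injective v≢w false false _  = refl
if-injective v≢w true  false eq = ⊥-elim (v≢w eq)
if-injective v≢w false true  eq = ⊥-elim (v≢w (sym eq))

xor-cancelʳ : ∀ a b c → a xor c ≡ b xor c → a ≡ b
xor-cancelʳ true  true  _ _  = refl
xor-cancelʳ false false _ _  = refl
xor-cancelʳ true  false c eq = ⊥-elim (not-¬ refl (sym eq))
xor-cancelʳ false true  c eq = ⊥-elim (not-¬ refl eq)

*-cancelˡ-≢0 : ∀ r {x y} → r ≢ 0ℚ → r * x ≡ r * y → x ≡ y
*-cancelˡ-≢0 r {x} {y} r≢0 rx≡ry = begin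
  x              ≡⟨ sym (unscale x) ⟩
  1/ r * (r * x) ≡⟨ cong (1/ r *_) rx≡ry ⟩
  1/ r * (r * y) ≡⟨ unscale y ⟩
  y              ∎
  where
  instance _ = ≢-nonZero r≢0
  unscale : ∀ z → 1/ r * (r * z) ≡ z
  unscale z = trans (sym (*-assoc (1/ r) r z)) (trans (cong (_* z) (*-inverseˡ r)) (*-identityˡ z))

combination-injectiveˡ : ∀ {α β x x′ y y′} → α ≢ 0ℚ → β ≡ 0ℚ →
                         α * x + β * y ≡ α * x′ + β * y′ → x ≡ x′
combination-injectiveˡ {α} {x = x} {x′} {y} {y′} α≢0 refl eq =
  *-cancelˡ-≢0 α α≢0 (trans (sym (drop x y)) (trans eq (drop x′ y′)))
  where
  drop : ∀ u z → α * u + 0ℚ * z ≡ α * u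
  drop u z = trans (cong ((α * u) +_) (*-zeroˡ z)) (+-identityʳ (α * u))

combination-injectiveʳ : ∀ {α β x x′ y y′} → β ≢ 0ℚ → x ≡ x′ →
                         α * x + β * y ≡ α * x′ + β * y′ → y ≡ y′
combination-injectiveʳ {α} {β} {x} β≢0 refl eq = *-cancelˡ-≢0 β β≢0 (∙-cancelˡ (α * x) _ _ eq)

sumFin≡sum : ∀ n (f : Fin n → ℚ) → sumFin n f ≡ sum f
sumFin≡sum zero    f = refl
sumFin≡sum (suc n) f = cong (f fz +_) (sumFin≡sum n (f ∘ fs))

sumFin-cong : ∀ n {f g : Fin n → ℚ} → (∀ i → f i ≡ g i) → sumFin n f ≡ sumFin n g
sumFin-cong n {f} {g} f≗g = trans (sumFin≡sum n f) (trans (sum-cong-≗ f≗g) (sym (sumFin≡sum n g)))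

sumFin-linear : ∀ n α β (f g : Fin n → ℚ) →
                sumFin n (λ i → α * f i + β * g i) ≡ α * sumFin n f + β * sumFin n g
sumFin-linear n α β f g = begin
  sumFin n (λ i → α * f i + β * g i)            ≡⟨ sumFin≡sum n _ ⟩
  sum (λ i → α * f i + β * g i)                 ≡⟨ ∑-distrib-+ (λ i → α * f i) (λ i → β * g i) ⟩
  sum (λ i → α * f i) + sum (λ i → β * g i)     ≡⟨ sym (cong₂ _+_ (*-distribˡ-sum α f) (*-distribˡ-sum β g)) ⟩
  α * sum f + β * sum g                         ≡⟨ sym (cong₂ (λ a b → α * a + β * b) (sumFin≡sum n f) (sumFin≡sum n g)) ⟩
  α * sumFin n f + β * sumFin n g               ∎

sumFin-supported : ∀ n (f : Fin n → ℚ) i → (∀ j → j ≢ i → f j ≡ 0ℚ) → sumFin n f ≡ f i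
sumFin-supported (suc n) f i vanishes = begin
  sumFin (suc n) f                          ≡⟨ sumFin≡sum (suc n) f ⟩
  sum f                                     ≡⟨ sum-remove f ⟩
  f i + sum (λ j → f (punchIn i j))         ≡⟨ cong (f i +_) (sum-cong-≗ (λ j → vanishes _ (punchInᵢ≢i i j))) ⟩
  f i + sum {n} (λ _ → 0ℚ)                  ≡⟨ cong (f i +_) (sum-replicate-zero n) ⟩
  f i + 0ℚ                                  ≡⟨ +-identityʳ (f i) ⟩
  f i                                       ∎

coeff : {k : ℕ} → Fin k → Fin k → ℚ
coeff v i = (ℤ.+ toℕ v ℤ.- ℤ.+ toℕ i) / 1

↥-/1 : ∀ z → ↥ (z / 1) ≡ z
↥-/1 z = begin
  ↥ (z / 1)                ≡⟨ sym (ℤ.*-identityʳ _) ⟩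
  ↥ (z / 1) ℤ.* 1ℤ         ≡⟨ cong (↥ (z / 1) ℤ.*_) (sym (gcd-zeroʳ z)) ⟩
  ↥ (z / 1) ℤ.* gcd z 1ℤ   ≡⟨ ↥-/ z 1 ⟩
  z                        ∎

coeff-diag : {k : ℕ} (i : Fin k) → coeff i i ≡ 0ℚ
coeff-diag i = cong (_/ 1) (ℤ.i≡j⇒i-j≡0 {ℤ.+ toℕ i} refl)

coeff-injective : {k : ℕ} {v w i : Fin k} → coeff v i ≡ coeff w i → v ≡ w
coeff-injective {i = i} eq = toℕ-injective (ℤ.+-injective (+-cancelʳ (ℤ.- ℤ.+ toℕ i) _ _
  (trans (sym (↥-/1 _)) (trans (cong ↥_ eq) (↥-/1 _)))))
  where open GroupProperties (AbelianGroup.group ℤ.+-0-abelianGroup) renaming (∙-cancelʳ to +-cancelʳ)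

sel-cong : {k : ℕ} (J J′ : Subset k) (p : Point k) {j : Fin k} →
           lookup J j ≡ lookup J′ j → sel J p j ≡ sel J′ p j
sel-cong J J′ (x , y) {j} = cong (λ b → if b then x j else y j)

sel-linear : {k : ℕ} (J : Subset k) (u w : Point k) (α β : ℚ) (i : Fin k) →
             sel J ((α • u) ⊕ (β • w)) i ≡ α * sel J u i + β * sel J w i
sel-linear J u w α β i with lookup J i
... | true  = refl
... | false = refl

ψ-linear : {k : ℕ} (x : PsiIndex k) (u w : Point k) (α β : ℚ) →
           ψ x ((α • u) ⊕ (β • w)) ≡ α * ψ x u + β * ψ x w
ψ-linear {k} (v , J) u w α β = trans (sumFin-cong k termwise) (sumFin-linear k α β _ _)
  where
  open +-*-Solver
  distrib : ∀ c a b x y → c * (a * x + b * y) ≡ a * (c * x) + b * (c * y)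
  distrib = solve 5 (λ c a b x y → c :* (a :* x :+ b :* y) := a :* (c :* x) :+ b :* (c :* y)) refl
  termwise : ∀ i → coeff v i * sel J ((α • u) ⊕ (β • w)) i
                 ≡ α * (coeff v i * sel J u i) + β * (coeff v i * sel J w i)
  termwise i = trans (cong (coeff v i *_) (sel-linear J u w α β i)) (distrib (coeff v i) α β _ _)

δ : {k : ℕ} → Fin k → Fin k → ℚ
δ i j = if does (j ≟ i) then 1ℚ else 0ℚ

δ-diag : {k : ℕ} (i : Fin k) → δ i i ≡ 1ℚ
δ-diag i = if-cong (dec-true (i ≟ i) refl)

δ-off : {k : ℕ} {i j : Fin k} → j ≢ i → δ i j ≡ 0ℚ
δ-off {i = i} {j} j≢i = if-cong (dec-false (j ≟ i) j≢i)

offBlock : {k : ℕ} → Bool → (Fin k → ℚ) → Point k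
offBlock true  u = (λ _ → 0ℚ) , u
offBlock false u = u , (λ _ → 0ℚ)

sel-offBlock : {k : ℕ} (J : Subset k) (b : Bool) (u : Fin k → ℚ) (j : Fin k) →
               sel J (offBlock b u) j ≡ (if lookup J j xor b then u j else 0ℚ)
sel-offBlock J true  u j with lookup J j
... | true  = refl
... | false = refl
sel-offBlock J false u j with lookup J j
... | true  = refl
... | false = refl

-- f_i is the unit vector e_i placed in the block that I does not select at i.
testPoint : {k : ℕ} → Subset k → Fin k → Point k
testPoint I i = offBlock (lookup I i) (δ i)

sel-testPoint-off : {k : ℕ} (J I : Subset k) {i j : Fin k} → j ≢ i → sel J (testPoint I i) j ≡ 0ℚ
sel-testPoint-off J I {i} {j} j≢i = begin
  sel J (testPoint I i) j                            ≡⟨ sel-offBlock J (lookup I i) (δ i) j ⟩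
  (if lookup J j xor lookup I i then δ i j else 0ℚ)  ≡⟨ if-cong-then (lookup J j xor lookup I i) (δ-off j≢i) ⟩
  (if lookup J j xor lookup I i then 0ℚ else 0ℚ)     ≡⟨ if-eta (lookup J j xor lookup I i) ⟩
  0ℚ                                                 ∎

sel-testPoint-diag : {k : ℕ} (J I : Subset k) (i : Fin k) →
                     sel J (testPoint I i) i ≡ (if lookup J i xor lookup I i then 1ℚ else 0ℚ)
sel-testPoint-diag J I i =
  trans (sel-offBlock J (lookup I i) (δ i) i) (if-cong-then (lookup J i xor lookup I i) (δ-diag i))

testPoint∈Π : {k : ℕ} (I : Subset k) (i : Fin k) → InΠ I (testPoint I i)
testPoint∈Π {k} I i = begin
  sumFin k (sel I (testPoint I i))                    ≡⟨ sumFin-supported k _ i (λ _ → sel-testPoint-off I I) ⟩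
  sel I (testPoint I i) i                             ≡⟨ sel-testPoint-diag I I i ⟩
  (if lookup I i xor lookup I i then 1ℚ else 0ℚ)      ≡⟨ if-cong (xor-same (lookup I i)) ⟩
  0ℚ                                                  ∎

testIndex : {k : ℕ} → Subset k → Fin k → PsiIndex k → Fin k
testIndex I i (v , J) = if lookup J i xor lookup I i then v else i

ψ-testPoint : {k : ℕ} (I : Subset k) (i : Fin k) (x : PsiIndex k) →
              ψ x (testPoint I i) ≡ coeff (testIndex I i x) i
ψ-testPoint {k} I i (v , J) = begin
  ψ (v , J) (testPoint I i)                           ≡⟨ sumFin-supported k _ i off ⟩
  coeff v i * sel J (testPoint I i) i                 ≡⟨ cong (coeff v i *_) (sel-testPoint-diag J I i) ⟩
  coeff v i * (if b then 1ℚ else 0ℚ)                  ≡⟨ scale b ⟩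
  coeff (if b then v else i) i                        ∎
  where
  b = lookup J i xor lookup I i
  off : ∀ j → j ≢ i → coeff v j * sel J (testPoint I i) j ≡ 0ℚ
  off j j≢i = trans (cong (coeff v j *_) (sel-testPoint-off J I j≢i)) (*-zeroʳ (coeff v j))
  scale : ∀ b → coeff v i * (if b then 1ℚ else 0ℚ) ≡ coeff (if b then v else i) i
  scale true  = *-identityʳ (coeff v i)
  scale false = trans (*-zeroʳ (coeff v i)) (sym (coeff-diag i))

-- At j ≠ v the value at f_j recovers whether j ∈ J; at j = v the coefficient vanishes.
ψ-determinedByTestPoints : {k : ℕ} (I : Subset k) (x y : PsiIndex k) → proj₁ x ≡ proj₁ y →
                           (∀ j → ψ x (testPoint I j) ≡ ψ y (testPoint I j)) →
                           ∀ p → ψ x p ≡ ψ y p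
ψ-determinedByTestPoints {k} I (v , J) (.v , J′) refl agree p = sumFin-cong k termwise
  where
  sameMembership : ∀ {j} → v ≢ j → lookup J j ≡ lookup J′ j
  sameMembership {j} v≢j =
    xor-cancelʳ _ _ (lookup I j) (if-injective v≢j _ _ (coeff-injective {i = j}
      (trans (sym (ψ-testPoint I j (v , J))) (trans (agree j) (ψ-testPoint I j (v , J′))))))
  termwise : ∀ j → coeff v j * sel J p j ≡ coeff v j * sel J′ p j
  termwise j with v ≟ j
  ... | yes refl rewrite coeff-diag v = trans (*-zeroˡ (sel J p v)) (sym (*-zeroˡ (sel J′ p v)))
  ... | no v≢j = cong (coeff v j *_) (sel-cong J J′ p (sameMembership v≢j))

DistinctOnΠ : {k s : ℕ} → Subset k → (Fin s → PsiIndex k) → Set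
DistinctOnΠ I ψs = ∀ a b → ¬ a ≡ b → ¬ SameOnΠ I (ψ (ψs a)) (ψ (ψs b))

-- Take α f + β p ∈ W with (α, β) ≠ 0: β = 0 would put f in W, and β ≠ 0 transfers
-- the agreement at f to p.
agreeAtSeparating⇒sameOnΠ : {k s : ℕ} (I : Subset k) (ψs : Fin s → PsiIndex k) {f : Point k}
                            {a b c d : Fin s} → CodimLe1 I ψs → InΠ I f →
                            ψ (ψs a) f ≢ ψ (ψs b) f → ψ (ψs c) f ≡ ψ (ψs d) f →
                            SameOnΠ I (ψ (ψs c)) (ψ (ψs d))
agreeAtSeparating⇒sameOnΠ I ψs {f} {a} {b} {c} {d} codim f∈Π separates agree p p∈Π
  with codim f p f∈Π p∈Π
... | α , β , notBothZero , _ , equalInW = case (β ≟ℚ 0ℚ)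
  where
  onCombination : ∀ x y → α * ψ (ψs x) f + β * ψ (ψs x) p ≡ α * ψ (ψs y) f + β * ψ (ψs y) p
  onCombination x y =
    trans (sym (ψ-linear (ψs x) f p α β)) (trans (equalInW x y) (ψ-linear (ψs y) f p α β))
  case : Dec (β ≡ 0ℚ) → ψ (ψs c) p ≡ ψ (ψs d) p
  case (yes β≡0) = ⊥-elim (separates
    (combination-injectiveˡ {α} {β} (λ α≡0 → notBothZero (α≡0 , β≡0)) β≡0 (onCombination a b)))
  case (no β≢0)  = combination-injectiveʳ {α} {β} β≢0 agree (onCombination c d)

sameV⇒separatingTestPoint : {k s : ℕ} (I : Subset k) (ψs : Fin s → PsiIndex k) →
                                DistinctOnΠ I ψs → {a b : Fin s} → a ≢ b →
                                proj₁ (ψs a) ≡ proj₁ (ψs b) →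
                                ∃ λ i → ψ (ψs a) (testPoint I i) ≢ ψ (ψs b) (testPoint I i)
sameV⇒separatingTestPoint {k} I ψs distinct {a} {b} a≢b sameV =
  ¬∀⟶∃¬ k _ (λ i → ψ (ψs a) (testPoint I i) ≟ℚ ψ (ψs b) (testPoint I i))
    (λ agree → distinct a b a≢b (λ p _ → ψ-determinedByTestPoints I (ψs a) (ψs b) sameV agree p))

separatingTestPoint⇒testIndex-injective :
  {k s : ℕ} (I : Subset k) (ψs : Fin s → PsiIndex k) → DistinctOnΠ I ψs → CodimLe1 I ψs →
  {a b : Fin s} {i : Fin k} → ψ (ψs a) (testPoint I i) ≢ ψ (ψs b) (testPoint I i) →
  Injective _≡_ _≡_ (λ c → testIndex I i (ψs c))
separatingTestPoint⇒testIndex-injective I ψs distinct codim {i = i} separates {c} {d} sameIndex =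
  decidable-stable (c ≟ d) (λ c≢d → distinct c d c≢d
    (agreeAtSeparating⇒sameOnΠ I ψs codim (testPoint∈Π I i) separates agreeAtTestPoint))
  where
  agreeAtTestPoint : ψ (ψs c) (testPoint I i) ≡ ψ (ψs d) (testPoint I i)
  agreeAtTestPoint = trans (ψ-testPoint I i (ψs c))
    (trans (cong (λ w → coeff w i) sameIndex) (sym (ψ-testPoint I i (ψs d))))

lemma6p5 : (k : ℕ) → 2 ≤ k → (I : Subset k) → (s : ℕ) → (ψs : Fin s → PsiIndex k)
    → (∀ a b → ¬ a ≡ b → ¬ SameOnΠ I (ψ (ψs a)) (ψ (ψs b)))
    → CodimLe1 I ψs
    → s ≤ k
lemma6p5 k _ I s ψs distinct codim with s ≤? k
... | yes s≤k = s≤k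
... | no s≰k with pigeonhole (≰⇒> s≰k) (proj₁ ∘ ψs)
...   | a , b , a<b , sameV with sameV⇒separatingTestPoint I ψs distinct (<⇒≢ a<b) sameV
...     | i , separates = injective⇒≤ (separatingTestPoint⇒testIndex-injective I ψs distinct codim separates)
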